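{- For every Erdős–Szekeres tableau $T$ of size $n$, the order poset satisfies $\mathrm{Height}(P(T))\ge 2\sqrt{n}-1$.
   Context: For a sequence $A=(a_1,\dots,a_n)$ of distinct real numbers, $a_i^+$ (resp. $a_i^-$) is the length of the longest increasing (resp. decreasing) subsequence of $A$ ending at $a_i$; the EST of $A$ is $T(A)=((a_i^+,a_i^-))_{i\le n}$. A sequence $A$ is identified with the linear order $i<_A j$ iff $a_i<a_j$ on $[n]$; $[T]$ is the set of such orders with $T(A)=T$; the order poset $P(T)$ on $[n]$ has $i<_{P(T)}j$ iff $i<_A j$ for all $A\in[T]$. The height of a poset is the maximum number of elements in a chain. -}

module Defs where

open import Data.Nat using (ℕ; suc; _+_; _*_; _≤_) renaming (_<_ to _<ℕ_)
open import Data.Fin using (Fin) renaming (_<_ to _<ᶠ_)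
open import Data.List using (List; []; _∷_; _++_; [_]; length)
open import Data.List.Relation.Unary.AllPairs using (AllPairs)
open import Data.Product using (_×_; Σ; ∃; proj₁; proj₂)
open import Function.Definitions using (Injective)
open import Relation.Binary.PropositionalEquality using (_≡_)

-- A sequence of n distinct numbers, a_i = A i.  Only the relative order of the
-- entries matters, so distinct naturals represent all linear orders on [n]
-- exactly as distinct reals do.
record Seq (n : ℕ) : Set where
  constructor mkSeq
  field
    val      : Fin n → ℕ
    distinct : Injective _≡_ _≡_ val
open Seq public

-- An increasing (resp. decreasing) subsequence ending at position i:
-- a list of earlier positions xs such that along xs ++ [ i ] the positions
-- strictly increase and the values strictly increase (resp. decrease).
-- Its length is length xs + 1.
IncEndingAt : ∀ {n} → Seq n → Fin n → List (Fin n) → Set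
IncEndingAt A i xs = AllPairs (λ p q → p <ᶠ q × val A p <ℕ val A q) (xs ++ [ i ])

DecEndingAt : ∀ {n} → Seq n → Fin n → List (Fin n) → Set
DecEndingAt A i xs = AllPairs (λ p q → p <ᶠ q × val A q <ℕ val A p) (xs ++ [ i ])

IsPlus : ∀ {n} → Seq n → Fin n → ℕ → Set
IsPlus A i k =
  (Σ (List _) λ xs → IncEndingAt A i xs × length xs + 1 ≡ k) ×
  (∀ xs → IncEndingAt A i xs → length xs + 1 ≤ k)

IsMinus : ∀ {n} → Seq n → Fin n → ℕ → Set
IsMinus A i k =
  (Σ (List _) λ xs → DecEndingAt A i xs × length xs + 1 ≡ k) ×
  (∀ xs → DecEndingAt A i xs → length xs + 1 ≤ k)

Tableau : ℕ → Set
Tableau n = Fin n → ℕ × ℕ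

HasEST : ∀ {n} → Seq n → Tableau n → Set
HasEST A T = ∀ i → IsPlus A i (proj₁ (T i)) × IsMinus A i (proj₂ (T i))

IsEST : ∀ {n} → Tableau n → Set
IsEST T = ∃ λ A → HasEST A T

_<[_]_ : ∀ {n} → Fin n → Tableau n → Fin n → Set
i <[ T ] j = ∀ A → HasEST A T → val A i <ℕ val A j

IsChain : ∀ {n} → Tableau n → List (Fin n) → Set
IsChain T = AllPairs (λ i j → i <[ T ] j)

-- Fix a sequence A realising T and write a⁺ , a⁻ for the two labels.  The
-- labels alone force certain comparisons in every sequence of [T]:
--   * "drops": a later position whose a⁺ does not exceed that of an earlier
--     one has a smaller value (dually for a⁻);
--   * "covers": if a⁺ jumps by one from i to j and no position strictly
--     between carries the label a⁺ᵢ, then aᵢ < aⱼ (dually for a⁻).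
-- These forced comparisons form a decidable relation which is acyclic, so
-- each position x has a longest forced chain x < y₁ < … (a chain of P(T));
-- let rank x be its number of elements and H = max rank.  Walking along
-- covers shows a⁻ₓ ≤ rank x and rank x + a⁺ₓ ≤ H + 1, while drops show that
-- x ↦ (rank x , a⁺ₓ) and x ↦ (rank x , a⁻ₓ) are injective.  A purely
-- arithmetic counting lemma turns these facts into 4n ≤ (H + 1)², and the
-- longest chain has H elements.
module Submission where

open import Defs
open import Data.Nat
  using (ℕ; zero; suc; _+_; _*_; _∸_; _≤_; _<_; _≤?_; _≟_; z≤n; s≤s; s≤s⁻¹; ⌊_/2⌋; ⌈_/2⌉)
open import Data.Nat.Properties
  using ( ≤-refl; ≤-trans; ≤-reflexive; ≤-antisym; <-trans; <-irrefl; <-≤-trans; ≤-<-trans; <⇒≤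
        ; ≰⇒>; <-cmp; suc-injective; 1+n≰n; +-comm; ∸-monoʳ-<; ∸-cancelˡ-≡; m<n⇒0<n∸m
        ; m≤o∸n⇒m+n≤o; m+n≤o⇒m≤o∸n; m+n∸m≡n; m≤n+m; m≤m+n; m≤n⇒∃[o]m+o≡n
        ; *-monoʳ-≤; <-isStrictPartialOrder; ⌊n/2⌋+⌈n/2⌉≡n; ⌊n/2⌋≤⌈n/2⌉
        ; module ≤-Reasoning )
open import Data.Nat.Solver using (module +-*-Solver)
open import Data.Fin using (Fin; fromℕ<; combine) renaming (_<_ to _<ᶠ_; _>_ to _>ᶠ_)
import Data.Fin as Fin
import Data.Fin.Properties as Fin
open import Data.Fin.Induction using (>-wellFounded; spo-noetherian)
open import Data.List using (List; []; _∷_; _++_; [_]; length; allFin; initLast; _∷ʳ′_)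
open import Data.List.Properties using (length-++)
open import Data.List.Relation.Unary.All as All using (All; []; _∷_)
import Data.List.Relation.Unary.All.Properties as All
open import Data.List.Relation.Unary.Any using (Any; here; there)
open import Data.List.Relation.Unary.AllPairs using (AllPairs; []; _∷_)
import Data.List.Relation.Unary.AllPairs.Properties as AllPairs
open import Data.List.Relation.Unary.Linked as Linked using (Linked; [-]; _∷_)
open import Data.List.Relation.Unary.Linked.Properties using (Linked⇒AllPairs)
open import Data.List.Membership.Propositional using (_∈_)
open import Data.List.Membership.Propositional.Properties using (∈-allFin)
open import Data.List.Extrema.Nat using (argmax; argmax-all; f[xs]≤f[argmax]; v≤f[argmax]⁺)
open import Data.Empty using (⊥; ⊥-elim)
open import Data.Product using (Σ; _×_; _,_; proj₁; proj₂)
open import Data.Sum using (_⊎_; inj₁; inj₂)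
import Data.Sum as Sum
open import Function using (flip; _∘_)
open import Induction.WellFounded using (WellFounded; Acc; acc; WfRec)
open import Relation.Binary using (Decidable; Transitive; tri<; tri≈; tri>)
import Relation.Binary.Construct.On as On
open import Relation.Nullary using (¬_; Dec; yes; no; contradiction)
open import Relation.Nullary.Decidable using (_×-dec_; _⊎-dec_; _→-dec_; ¬?)
open import Relation.Binary.PropositionalEquality
  using (_≡_; _≢_; refl; sym; trans; cong; cong₂; subst)

module _ {A : Set} {Q : A → A → Set} where

  allPairs-toLast : ∀ xs {x} → AllPairs Q (xs ++ [ x ]) → All (λ a → Q a x) xs
  allPairs-toLast []       _          = []
  allPairs-toLast (a ∷ xs) (qa ∷ qas) = All.head (All.++⁻ʳ xs qa) ∷ allPairs-toLast xs qas

  allPairs-init : ∀ xs {ys} → AllPairs Q (xs ++ ys) → AllPairs Q xs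
  allPairs-init []       _          = []
  allPairs-init (a ∷ xs) (qa ∷ qas) = All.++⁻ˡ xs qa ∷ allPairs-init xs qas

  allPairs-snoc : ∀ {xs y} → AllPairs Q xs → All (λ a → Q a y) xs → AllPairs Q (xs ++ [ y ])
  allPairs-snoc qs qy = AllPairs.++⁺ qs ([] ∷ []) (All.map (_∷ []) qy)

-- xs ++ [ i ] lists positions of A in increasing order along which the values
-- increase for the order ≺.  For ≺ = _<_ this is IncEndingAt, for
-- ≺ = flip _<_ it is DecEndingAt.
MonotoneEndingAt : ∀ {n} → Seq n → (ℕ → ℕ → Set) → Fin n → List (Fin n) → Set
MonotoneEndingAt A _≺_ i xs = AllPairs (λ p q → p <ᶠ q × val A p ≺ val A q) (xs ++ [ i ])

-- k is the length of a longest ≺-monotone subsequence of A ending at i;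
-- IsPlus and IsMinus are the instances ≺ = _<_ and ≺ = flip _<_.
IsLongest : ∀ {n} → Seq n → (ℕ → ℕ → Set) → Fin n → ℕ → Set
IsLongest A _≺_ i k =
  (Σ (List _) λ xs → MonotoneEndingAt A _≺_ i xs × length xs + 1 ≡ k) ×
  (∀ xs → MonotoneEndingAt A _≺_ i xs → length xs + 1 ≤ k)

Drop : ∀ {n} → (Fin n → ℕ) → Fin n → Fin n → Set
Drop lab x y = x <ᶠ y × lab y ≤ lab x

Cover : ∀ {n} → (Fin n → ℕ) → Fin n → Fin n → Set
Cover lab x y = x <ᶠ y × lab y ≡ suc (lab x) × (∀ w → x <ᶠ w → w <ᶠ y → lab w ≢ lab x)

drop? : ∀ {n} (lab : Fin n → ℕ) → Decidable (Drop lab)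
drop? lab x y = (x Fin.<? y) ×-dec (lab y ≤? lab x)

cover? : ∀ {n} (lab : Fin n → ℕ) → Decidable (Cover lab)
cover? lab x y =
  (x Fin.<? y) ×-dec ((lab y ≟ suc (lab x)) ×-dec
    Fin.all? (λ w → (x Fin.<? w) →-dec ((w Fin.<? y) →-dec ¬? (lab w ≟ lab x))))

lastBefore : ∀ {n} {Q : Fin n → Set} → (∀ w → Dec (Q w)) → ∀ {x z : Fin n} → Acc _>ᶠ_ z →
  z <ᶠ x → Q z → Σ (Fin n) λ y → y <ᶠ x × Q y × (∀ w → y <ᶠ w → w <ᶠ x → ¬ Q w)
lastBefore Q? {x} {z} (acc later) z<x qz
  with Fin.any? (λ w → (z Fin.<? w) ×-dec ((w Fin.<? x) ×-dec Q? w))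
... | yes (w , z<w , w<x , qw) = lastBefore Q? (later z<w) w<x qw
... | no none = z , z<x , qz , λ w z<w w<x qw → none (w , z<w , w<x , qw)

module LongestMonotone {n} (A : Seq n) (_≺_ : ℕ → ℕ → Set) (≺-trans : Transitive _≺_)
  (≺-connex : ∀ {a b} → a ≢ b → a ≺ b ⊎ b ≺ a)
  (lab : Fin n → ℕ) (longest : ∀ i → IsLongest A _≺_ i (lab i)) where

  private
    v : Fin n → ℕ
    v = val A

    Step : Fin n → Fin n → Set
    Step p q = p <ᶠ q × v p ≺ v q

  -- Appending j to a longest sequence ending at an earlier, ≺-smaller i
  -- gives a longer sequence ending at j.
  lab-step : ∀ {i j} → i <ᶠ j → v i ≺ v j → lab i < lab j
  lab-step {i} {j} i<j vi≺vj with proj₁ (longest i)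
  ... | xs , mono , len = begin
      suc (lab i)                  ≡⟨ +-comm 1 (lab i) ⟩
      lab i + 1                    ≡⟨ cong (_+ 1) (sym len) ⟩
      length xs + 1 + 1            ≡⟨ cong (_+ 1) (sym (length-++ xs)) ⟩
      length (xs ++ [ i ]) + 1     ≤⟨ proj₂ (longest j) (xs ++ [ i ]) extended ⟩
      lab j                        ∎
    where
    open ≤-Reasoning
    i→j : Step i j
    i→j = i<j , vi≺vj
    extended : MonotoneEndingAt A _≺_ j (xs ++ [ i ])
    extended = allPairs-snoc mono
      (All.++⁺ (All.map (λ (p<i , vp≺vi) → Fin.<-trans p<i i<j , ≺-trans vp≺vi vi≺vj)
                        (allPairs-toLast xs mono))
               (i→j ∷ []))

  -- A longest sequence has at least one entry, so labels are positive.
  lab-positive : ∀ i → 1 ≤ lab i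
  lab-positive i = subst (1 ≤_) (proj₂ (proj₂ (proj₁ (longest i)))) (m≤n+m 1 _)

  -- A label ≥ 2 is attained through the second-to-last entry z of a longest
  -- sequence: z is earlier, ≺-smaller, and has label one less.
  lab-pred : ∀ x → 2 ≤ lab x → Σ (Fin n) λ z → z <ᶠ x × v z ≺ v x × lab x ≡ suc (lab z)
  lab-pred x 2≤lab with proj₁ (longest x)
  ... | xs , mono , len with initLast xs
  ...   | [] = contradiction (subst (2 ≤_) (sym len) 2≤lab) λ { (s≤s ()) }
  ...   | ws ∷ʳ′ z = z , proj₁ z→x , proj₂ z→x , ≤-antisym lab≤ (lab-step (proj₁ z→x) (proj₂ z→x))
    where
    open ≤-Reasoning
    z→x : Step z x
    z→x = All.head (All.++⁻ʳ ws (allPairs-toLast (ws ++ [ z ]) mono))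
    lab≤ : lab x ≤ suc (lab z)
    lab≤ = begin
      lab x                      ≡⟨ sym len ⟩
      length (ws ++ [ z ]) + 1   ≡⟨ +-comm _ 1 ⟩
      suc (length (ws ++ [ z ])) ≡⟨ cong suc (length-++ ws) ⟩
      suc (length ws + 1)        ≤⟨ s≤s (proj₂ (longest z) ws (allPairs-init (ws ++ [ z ]) mono)) ⟩
      suc (lab z)                ∎

  -- If the label does not grow from x to a later y, then v y ≺ v x:
  -- otherwise y would extend a longest sequence ending at x.
  drop-sound : ∀ {x y} → Drop lab x y → v y ≺ v x
  drop-sound (x<y , lab≤) with ≺-connex (λ vx≡vy → Fin.<⇒≢ x<y (distinct A vx≡vy))
  ... | inj₁ vx≺vy = contradiction (≤-trans (lab-step x<y vx≺vy) lab≤) 1+n≰n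
  ... | inj₂ vy≺vx = vy≺vx

  -- A cover is a forced increase: the predecessor z of y from lab-pred is x
  -- itself or lies before x (never strictly between them), and in the latter
  -- case the drop from z to x gives v x ≺ v z ≺ v y.
  cover-sound : ∀ {x y} → Cover lab x y → v x ≺ v y
  cover-sound {x} {y} (x<y , ly≡1+lx , gap)
    with lab-pred y (subst (2 ≤_) (sym ly≡1+lx) (s≤s (lab-positive x)))
  ... | z , z<y , vz≺vy , ly≡1+lz
    with Fin.<-cmp z x | suc-injective (trans (sym ly≡1+lz) ly≡1+lx)
  ...   | tri< z<x _ _ | lz≡lx = ≺-trans (drop-sound (z<x , ≤-reflexive (sym lz≡lx))) vz≺vy
  ...   | tri≈ _ refl _ | _    = vz≺vy
  ...   | tri> _ _ x<z | lz≡lx = contradiction lz≡lx (gap z x<z z<y)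

  -- Every label ≥ 2 is reached by a cover: take the last position before x
  -- whose label equals that of the predecessor given by lab-pred.
  cover-exists : ∀ x → 2 ≤ lab x → Σ (Fin n) λ y → Cover lab y x
  cover-exists x 2≤lab with lab-pred x 2≤lab
  ... | z , z<x , _ , lx≡1+lz
    with lastBefore (λ w → lab w ≟ lab z) (>-wellFounded z) z<x refl
  ...   | y , y<x , ly≡lz , gap =
    y , y<x , trans lx≡1+lz (cong suc (sym ly≡lz)) ,
    λ w y<w w<x lw≡ly → gap w y<w w<x (trans lw≡ly ly≡lz)

  lab≤rank : (g : Fin n → ℕ) → (∀ x → 1 ≤ g x) →
    (∀ {y x} → Cover lab y x → g y < g x) → ∀ x → lab x ≤ g x
  lab≤rank g g-positive g-mono x₀ = climb (lab x₀) x₀ refl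
    where
    climb : ∀ k x → lab x ≡ k → lab x ≤ g x
    climb zero          x lx≡k = subst (_≤ g x) (sym lx≡k) z≤n
    climb (suc zero)    x lx≡k = subst (_≤ g x) (sym lx≡k) (g-positive x)
    climb (suc (suc k)) x lx≡k =
      let (y , y→x) = cover-exists x (subst (2 ≤_) (sym lx≡k) (s≤s (s≤s z≤n)))
          lx≡1+ly   = proj₁ (proj₂ y→x)
      in  begin
        lab x        ≡⟨ lx≡1+ly ⟩
        suc (lab y)  ≤⟨ s≤s (climb (suc k) y (suc-injective (trans (sym lx≡1+ly) lx≡k))) ⟩
        suc (g y)    ≤⟨ g-mono y→x ⟩
        g x          ∎
      where open ≤-Reasoning

-- Longest walks x → y₁ → y₂ → … along a decidable relation E on Fin n whose
-- steps decrease in a well-founded relation ⊏ (so every walk is finite).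
-- walk x is a longest such walk, found by recursion on ⊏: among the
-- extensions y ∷ walk y over all E-successors y, take the longest.
module LongestWalk {n} (E : Fin n → Fin n → Set) (E? : Decidable E)
  {_⊏_ : Fin n → Fin n → Set} (wf : WellFounded _⊏_) (E⇒⊏ : ∀ {x y} → E x y → y ⊏ x) where

  mutual
    walkFrom : ∀ x → Acc _⊏_ x → List (Fin n)
    walkFrom x (acc smaller) = argmax length [] (extensions x smaller (allFin n))

    extensions : ∀ x → WfRec _⊏_ (Acc _⊏_) x → List (Fin n) → List (List (Fin n))
    extensions x smaller []       = []
    extensions x smaller (y ∷ ys) with E? x y
    ... | yes x→y = (y ∷ walkFrom y (smaller (E⇒⊏ x→y))) ∷ extensions x smaller ys
    ... | no  _   = extensions x smaller ys

  mutual
    walkFrom-linked : ∀ x a → Linked E (x ∷ walkFrom x a)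
    walkFrom-linked x (acc smaller) =
      argmax-all length [-] (extensions-linked x smaller (allFin n))

    extensions-linked : ∀ x (smaller : WfRec _⊏_ (Acc _⊏_) x) ys →
      All (λ l → Linked E (x ∷ l)) (extensions x smaller ys)
    extensions-linked x smaller []       = []
    extensions-linked x smaller (y ∷ ys) with E? x y
    ... | yes x→y = (x→y ∷ walkFrom-linked y (smaller (E⇒⊏ x→y))) ∷ extensions-linked x smaller ys
    ... | no  _   = extensions-linked x smaller ys

  -- Every walk x ∷ y ∷ l is matched by the candidate y ∷ walkFrom y, which is
  -- at least as long by recursion, so no walk from x is longer.
  mutual
    walkFrom-longest : ∀ x a l → Linked E (x ∷ l) → length l ≤ length (walkFrom x a)
    walkFrom-longest x a             []      _           = z≤n
    walkFrom-longest x (acc smaller) (y ∷ l) (x→y ∷ y-l) =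
      v≤f[argmax]⁺ [] (extensions x smaller (allFin n))
        (inj₂ (extensions-longest x smaller x→y y-l (allFin n) (∈-allFin y)))

    extensions-longest : ∀ x (smaller : WfRec _⊏_ (Acc _⊏_) x) {y l} →
      E x y → Linked E (y ∷ l) → ∀ ys → y ∈ ys →
      Any (λ l′ → suc (length l) ≤ length l′) (extensions x smaller ys)
    extensions-longest x smaller {y} x→y y-l (z ∷ ys) y∈ with E? x z | y∈
    ... | yes x→z | here refl = here (s≤s (walkFrom-longest y (smaller (E⇒⊏ x→z)) _ y-l))
    ... | yes _   | there y∈ys = there (extensions-longest x smaller x→y y-l ys y∈ys)
    ... | no ¬x→y | here refl = contradiction x→y ¬x→y
    ... | no _    | there y∈ys = extensions-longest x smaller x→y y-l ys y∈ys

  -- The canonical longest walk from x.  It is kept opaque: only the two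
  -- facts below are used, and unfolding it would run the search.
  opaque
    walk : Fin n → List (Fin n)
    walk x = walkFrom x (wf x)

    walk-linked : ∀ x → Linked E (x ∷ walk x)
    walk-linked x = walkFrom-linked x (wf x)

    walk-longest : ∀ x l → Linked E (x ∷ l) → length l ≤ length (walk x)
    walk-longest x = walkFrom-longest x (wf x)

  height : Fin n → ℕ
  height x = length (x ∷ walk x)

  -- Prepending x to a longest walk from an E-successor y is a walk from x.
  height-desc : ∀ {x y} → E x y → height y < height x
  height-desc {x} {y} x→y = s≤s (walk-longest x (y ∷ walk y) (x→y ∷ walk-linked y))

box-bound : ∀ {n r t} (f : Fin n → ℕ × ℕ) →
  (∀ x → proj₁ (f x) < r × proj₂ (f x) < t) →
  (∀ x y → f x ≡ f y → x ≡ y) → n ≤ r * t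
box-bound {r = r} {t} f inBox f-injective = Fin.injective⇒≤ encode-injective
  where
  encode : _ → Fin (r * t)
  encode x = combine (fromℕ< (proj₁ (inBox x))) (fromℕ< (proj₂ (inBox x)))

  encode-injective : ∀ {x y} → encode x ≡ encode y → x ≡ y
  encode-injective {x} {y} e with Fin.combine-injective _ _ _ _ e
  ... | same₁ , same₂ = f-injective x y (cong₂ _,_
    (Fin.fromℕ<-injective _ _ (proj₁ (inBox x)) (proj₁ (inBox y)) same₁)
    (Fin.fromℕ<-injective _ _ (proj₂ (inBox x)) (proj₂ (inBox y)) same₂))

-- The arithmetic–geometric mean inequality 4rt ≤ (r + t)², for t ≤ r:
-- writing r = t + d, one has (r + t)² = 4rt + d².
am-gm : ∀ {r t} → t ≤ r → 4 * (r * t) ≤ (r + t) * (r + t)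
am-gm {r} {t} t≤r with m≤n⇒∃[o]m+o≡n t≤r
... | d , refl = subst (4 * ((t + d) * t) ≤_) square-expansion (m≤m+n _ (d * d))
  where
  open +-*-Solver
  square-expansion : 4 * ((t + d) * t) + d * d ≡ (t + d + t) * (t + d + t)
  square-expansion =
    solve 2 (λ t d → con 4 :* ((t :+ d) :* t) :+ d :* d
                  := ((t :+ d) :+ t) :* ((t :+ d) :+ t)) refl t d

⌈n/2⌉≤1+⌊n/2⌋ : ∀ s → ⌈ s /2⌉ ≤ suc ⌊ s /2⌋
⌈n/2⌉≤1+⌊n/2⌋ zero          = z≤n
⌈n/2⌉≤1+⌊n/2⌋ (suc zero)    = ≤-refl
⌈n/2⌉≤1+⌊n/2⌋ (suc (suc s)) = s≤s (⌈n/2⌉≤1+⌊n/2⌋ s)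

-- With t = ⌊s/2⌋ and
-- r = ⌈s/2⌉, points of rank ≤ t are coded by (p − 1, k − 1) and points of
-- rank > t by (s − k, q − 1); this places all of them injectively in the
-- box [0, r) × [0, t), and 4rt ≤ (r + t)² = s².
module Counting {n s : ℕ} (k p q : Fin n → ℕ)
  (p-positive : ∀ x → 1 ≤ p x) (q-positive : ∀ x → 1 ≤ q x)
  (p≤k : ∀ x → p x ≤ k x) (k+q≤s : ∀ x → k x + q x ≤ s)
  (kp-injective : ∀ x y → k x ≡ k y → p x ≡ p y → x ≡ y)
  (kq-injective : ∀ x y → k x ≡ k y → q x ≡ q y → x ≡ y) where

  private
    t r : ℕ
    t = ⌊ s /2⌋
    r = ⌈ s /2⌉

    t+r≡s : t + r ≡ s
    t+r≡s = ⌊n/2⌋+⌈n/2⌉≡n s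

    pred< : ∀ {a} → 1 ≤ a → a ∸ 1 < a
    pred< {suc a} _ = ≤-refl

    pred-injective : ∀ {a b} → 1 ≤ a → 1 ≤ b → a ∸ 1 ≡ b ∸ 1 → a ≡ b
    pred-injective {suc a} {suc b} _ _ e = cong suc e

    k-positive : ∀ x → 1 ≤ k x
    k-positive x = ≤-trans (p-positive x) (p≤k x)

    k≤s : ∀ x → k x ≤ s
    k≤s x = ≤-trans (m≤m+n (k x) (q x)) (k+q≤s x)

    q≤s∸k : ∀ x → q x ≤ s ∸ k x
    q≤s∸k x = m+n≤o⇒m≤o∸n (q x) (subst (_≤ s) (+-comm (k x) (q x)) (k+q≤s x))

    high< : ∀ x → t < k x → s ∸ k x < r
    high< x t<k = subst (s ∸ k x <_) s∸t≡r (∸-monoʳ-< t<k (k≤s x))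
      where
      s∸t≡r : s ∸ t ≡ r
      s∸t≡r = subst (λ m → m ∸ t ≡ r) t+r≡s (m+n∸m≡n t r)

    encode : Fin n → ℕ × ℕ
    encode x with k x ≤? t
    ... | yes _ = p x ∸ 1 , k x ∸ 1
    ... | no  _ = s ∸ k x , q x ∸ 1

    inBox : ∀ x → proj₁ (encode x) < r × proj₂ (encode x) < t
    inBox x with k x ≤? t
    ... | yes k≤t =
      <-≤-trans (pred< (p-positive x)) (≤-trans (p≤k x) (≤-trans k≤t (⌊n/2⌋≤⌈n/2⌉ s))) ,
      <-≤-trans (pred< (k-positive x)) k≤t
    ... | no  k≰t =
      high< x (≰⇒> k≰t) ,
      <-≤-trans (pred< (q-positive x)) (s≤s⁻¹ (≤-trans q<r (⌈n/2⌉≤1+⌊n/2⌋ s)))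
      where
      q<r : q x < r
      q<r = ≤-<-trans (q≤s∸k x) (high< x (≰⇒> k≰t))

    -- A low and a high point never share a code: that would force
    -- k x = q y ≤ s − k y = p x − 1 < p x ≤ k x.
    low≢high : ∀ x y → p x ∸ 1 ≡ s ∸ k y → k x ∸ 1 ≡ q y ∸ 1 → ⊥
    low≢high x y e₁ e₂ = <-irrefl refl (begin-strict
      k x         ≡⟨ kx≡qy ⟩
      q y         ≤⟨ q≤s∸k y ⟩
      s ∸ k y     ≡⟨ sym e₁ ⟩
      p x ∸ 1     <⟨ pred< (p-positive x) ⟩
      p x         ≤⟨ p≤k x ⟩
      k x         ∎)
      where
      open ≤-Reasoning
      kx≡qy : k x ≡ q y
      kx≡qy = pred-injective (k-positive x) (q-positive y) e₂

    encode-injective : ∀ x y → encode x ≡ encode y → x ≡ y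
    encode-injective x y e with k x ≤? t | k y ≤? t
    ... | yes _ | yes _ = kp-injective x y
      (pred-injective (k-positive x) (k-positive y) (cong proj₂ e))
      (pred-injective (p-positive x) (p-positive y) (cong proj₁ e))
    ... | no _  | no _  = kq-injective x y
      (∸-cancelˡ-≡ (k≤s x) (k≤s y) (cong proj₁ e))
      (pred-injective (q-positive x) (q-positive y) (cong proj₂ e))
    ... | yes _ | no _  = ⊥-elim (low≢high x y (cong proj₁ e) (cong proj₂ e))
    ... | no _  | yes _ = ⊥-elim (low≢high y x (sym (cong proj₁ e)) (sym (cong proj₂ e)))

  four-n≤s² : 4 * n ≤ s * s
  four-n≤s² = begin
    4 * n              ≤⟨ *-monoʳ-≤ 4 (box-bound encode inBox encode-injective) ⟩
    4 * (r * t)        ≤⟨ am-gm (⌊n/2⌋≤⌈n/2⌉ s) ⟩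
    (r + t) * (r + t)  ≡⟨ cong (λ m → m * m) (trans (+-comm r t) t+r≡s) ⟩
    s * s              ∎
    where open ≤-Reasoning

<-connex : ∀ {a b} → a ≢ b → a < b ⊎ b < a
<-connex {a} {b} a≢b with <-cmp a b
... | tri< a<b _ _ = inj₁ a<b
... | tri≈ _ a≡b _ = contradiction a≡b a≢b
... | tri> _ _ b<a = inj₂ b<a

module Forcing {n} (T : Tableau n) where

  plus minus : Fin n → ℕ
  plus  i = proj₁ (T i)
  minus i = proj₂ (T i)

  module Plus (A : Seq n) (h : HasEST A T) =
    LongestMonotone A _<_ <-trans <-connex plus (λ i → proj₁ (h i))
  module Minus (A : Seq n) (h : HasEST A T) =
    LongestMonotone A (flip _<_) (λ b<a c<b → <-trans c<b b<a) (Sum.swap ∘ <-connex)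
      minus (λ i → proj₂ (h i))

  Forced : Fin n → Fin n → Set
  Forced lo hi = Drop plus hi lo ⊎ Drop minus lo hi ⊎ Cover plus lo hi ⊎ Cover minus hi lo

  forced? : Decidable Forced
  forced? lo hi =
    drop? plus hi lo ⊎-dec drop? minus lo hi ⊎-dec cover? plus lo hi ⊎-dec cover? minus hi lo

  forced-sound : ∀ {lo hi} → Forced lo hi → lo <[ T ] hi
  forced-sound {lo} {hi} (inj₁ drop⁺)                A h = Plus.drop-sound A h {hi} {lo} drop⁺
  forced-sound {lo} {hi} (inj₂ (inj₁ drop⁻))         A h = Minus.drop-sound A h {lo} {hi} drop⁻
  forced-sound {lo} {hi} (inj₂ (inj₂ (inj₁ cover⁺))) A h = Plus.cover-sound A h {lo} {hi} cover⁺
  forced-sound {lo} {hi} (inj₂ (inj₂ (inj₂ cover⁻))) A h = Minus.cover-sound A h {hi} {lo} cover⁻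

  equal-plus⇒forced : ∀ {x y} → x <ᶠ y → plus x ≡ plus y → Forced x y ⊎ Forced y x
  equal-plus⇒forced x<y same = inj₂ (inj₁ (x<y , ≤-reflexive (sym same)))

  equal-minus⇒forced : ∀ {x y} → x <ᶠ y → minus x ≡ minus y → Forced x y ⊎ Forced y x
  equal-minus⇒forced x<y same = inj₁ (inj₂ (inj₁ (x<y , ≤-reflexive (sym same))))

  <[T]-trans : Transitive (λ i j → i <[ T ] j)
  <[T]-trans i<j j<k A h = <-trans (i<j A h) (j<k A h)

  -- Fix one sequence A realising T.  Forced steps increase the values of A,
  -- so forced walks are finite; rank x is the number of elements of a
  -- longest forced walk starting at x.
  module Ranks (A : Seq n) (hA : HasEST A T) where

    open LongestWalk Forced forced?
      (spo-noetherian (On.isStrictPartialOrder (val A) <-isStrictPartialOrder))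
      (λ lo→hi → forced-sound lo→hi A hA)
      public renaming (height to rank; height-desc to rank-desc)

    -- Along a cover of a⁻ from y to x, x is forced below y; so the rank grows
    -- along covers of a⁻ and bounds a⁻.
    minus≤rank : ∀ x → minus x ≤ rank x
    minus≤rank = Minus.lab≤rank A hA rank (λ _ → s≤s z≤n)
      (λ {y} {x} y→x → rank-desc {x} {y} (inj₂ (inj₂ (inj₂ y→x))))

    -- Along a cover of a⁺ from y to x, y is forced below x; so the co-rank
    -- H + 1 − rank grows along covers of a⁺ and bounds a⁺.
    rank+plus≤ : ∀ H → (∀ x → rank x ≤ H) → ∀ x → rank x + plus x ≤ H + 1
    rank+plus≤ H rank≤H x = subst (_≤ H + 1) (+-comm (plus x) (rank x))
      (m≤o∸n⇒m+n≤o (plus x) (<⇒≤ (rank<H+1 x))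
        (Plus.lab≤rank A hA corank corank-positive corank-mono x))
      where
      rank<H+1 : ∀ x → rank x < H + 1
      rank<H+1 x = subst (rank x <_) (+-comm 1 H) (s≤s (rank≤H x))

      corank : Fin n → ℕ
      corank x = H + 1 ∸ rank x

      corank-positive : ∀ x → 1 ≤ corank x
      corank-positive x = m<n⇒0<n∸m (rank<H+1 x)

      corank-mono : ∀ {y x} → Cover plus y x → corank y < corank x
      corank-mono {y} {x} y→x =
        ∸-monoʳ-< (rank-desc {y} {x} (inj₂ (inj₂ (inj₁ y→x)))) (<⇒≤ (rank<H+1 y))

    distinct-ranks : ∀ {x y} → Forced x y ⊎ Forced y x → rank x ≢ rank y
    distinct-ranks (inj₁ x→y) rx≡ry = <-irrefl (sym rx≡ry) (rank-desc x→y)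
    distinct-ranks (inj₂ y→x) rx≡ry = <-irrefl rx≡ry (rank-desc y→x)

    rank-separates : (lab : Fin n → ℕ) →
      (∀ {x y} → x <ᶠ y → lab x ≡ lab y → Forced x y ⊎ Forced y x) →
      ∀ x y → rank x ≡ rank y → lab x ≡ lab y → x ≡ y
    rank-separates lab comparable x y rx≡ry lx≡ly with Fin.<-cmp x y
    ... | tri< x<y _ _ = contradiction rx≡ry (distinct-ranks (comparable x<y lx≡ly))
    ... | tri≈ _ x≡y _ = x≡y
    ... | tri> _ _ y<x = contradiction (sym rx≡ry) (distinct-ranks (comparable y<x (sym lx≡ly)))

-- Height(P(T)) ≥ 2√n − 1: a longest forced walk from a position of maximal
-- rank is a chain c of P(T) with |c| + 1 = H + 1, and the counting lemma
-- applied to (rank, a⁻, a⁺) gives 4n ≤ (H + 1)².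
proposition1 : (n : ℕ) (T : Tableau n) → IsEST T →
    Σ (List _) λ c → IsChain T c × 4 * n ≤ (length c + 1) * (length c + 1)
proposition1 zero    T _        = [] , [] , z≤n
proposition1 (suc m) T (A , hA) = top ∷ walk top , chain , Counting.four-n≤s²
    rank minus plus (Minus.lab-positive A hA) (Plus.lab-positive A hA)
    minus≤rank (rank+plus≤ (rank top) rank≤top)
    (rank-separates minus equal-minus⇒forced) (rank-separates plus equal-plus⇒forced)
  where
  open Forcing T
  open Ranks A hA

  top : Fin (suc m)
  top = argmax rank Fin.zero (allFin (suc m))

  rank≤top : ∀ x → rank x ≤ rank top
  rank≤top x = All.lookup (f[xs]≤f[argmax] {f = rank} Fin.zero (allFin (suc m))) (∈-allFin x)

  chain : IsChain T (top ∷ walk top)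
  chain = Linked⇒AllPairs <[T]-trans (Linked.map forced-sound (walk-linked top))
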